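{- Let $p$ be a prime and let $G \simeq C_{n_1} \oplus \dots \oplus C_{n_r}$ be a finite abelian $p$-group, where $1 < n_1 \mid n_2 \mid \dots \mid n_r$. If $S$ is a zero-sumfree sequence in $G$ with $|S| \geq \mathsf{d}(G)-p+2$, then $n_1$ divides $\mathrm{ord}_G(g)$ for every term $g$ of $S$.
   Context: $C_n$ denotes the cyclic group of order $n$. A sequence in $G$ is a finite unordered list of elements with repetition allowed; $|S|$ is its length counted with multiplicity. A sequence is zero-sumfree if no nonempty subsequence has sum $0$. $\mathsf{d}(G)$ is the maximal length of a zero-sumfree sequence in $G$. $\mathrm{ord}_G(g)$ is the order of $g$ in $G$. -}

module Defs where

open import Data.Nat using (ℕ; zero; suc; _+_; _*_; _≤_; _<_)
open import Data.Nat.Divisibility using (_∣_)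
open import Data.Fin using (Fin; toℕ)
open import Data.List using (List; []; map; length)
open import Data.Nat.ListAction using (sum)
open import Data.List.Relation.Binary.Sublist.Propositional using (_⊆_)
open import Data.Product using (Σ; ∃; _×_)
open import Relation.Binary.PropositionalEquality using (_≡_; _≢_)
open import Relation.Nullary using (¬_)

-- The group G = C_{ns 0} ⊕ ... ⊕ C_{ns (k-1)} with k components.
-- An element is given by its canonical representatives (x_i mod ns i).
Elem : {k : ℕ} → (Fin k → ℕ) → Set
Elem {k} ns = (i : Fin k) → Fin (ns i)

Seq : {k : ℕ} → (Fin k → ℕ) → Set
Seq ns = List (Elem ns)

SumIsZero : {k : ℕ} (ns : Fin k → ℕ) → Seq ns → Set
SumIsZero ns T = ∀ i → ns i ∣ sum (map (λ g → toℕ (g i)) T)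

-- Subsequences = sublists (sub-multisets).
ZeroSumFree : {k : ℕ} (ns : Fin k → ℕ) → Seq ns → Set
ZeroSumFree ns S = ∀ (T : Seq ns) → T ⊆ S → T ≢ [] → ¬ SumIsZero ns T

IsSmallDavenport : {k : ℕ} (ns : Fin k → ℕ) → ℕ → Set
IsSmallDavenport ns D =
  (∃ λ (S : Seq ns) → ZeroSumFree ns S × length S ≡ D) ×
  (∀ (S : Seq ns) → ZeroSumFree ns S → length S ≤ D)

Annihilates : {k : ℕ} (ns : Fin k → ℕ) → ℕ → Elem ns → Set
Annihilates ns m g = ∀ i → ns i ∣ m * toℕ (g i)

IsOrder : {k : ℕ} (ns : Fin k → ℕ) → Elem ns → ℕ → Set
IsOrder ns g m = 0 < m × Annihilates ns m g × (∀ j → 0 < j → Annihilates ns j g → m ≤ j)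

-- Work modulo p with functions ℕʳ → ℤ and the differences Δₛ f x = f x - f (x + s); f has
-- degree < n when every n-fold difference of f vanishes.  Since Δₛ^(p^e) ≡ Δ_(p^e·s) (mod p),
-- the indicator of p^e ∣ xᵢ has degree < p^e, so the indicator of 0 ∈ G (their product) has
-- degree ≤ d*(G) = Σ (nᵢ - 1) ≤ d(G).  Each Δₛ lowers the degree by one, but if n₁ ∤ ord g
-- then p divides every coordinate of g and Δ_g ≡ Δ_h^p (g = p·h) lowers it by p.  So the
-- iterated difference along S vanishes mod p once |S| - 1 + p > d(G), while at 0 it equals 1
-- because no nonempty subsequence of S sums to zero.
module Submission where

open import Level using (0ℓ)
open import Algebra.Bundles using (CommutativeMonoid)
open import Algebra.Core using (Op₂)
open import Algebra.Structures using (IsCommutativeMonoid)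
open import Data.Bool using (if_then_else_)
open import Data.Fin using (Fin; zero; suc; toℕ; inject₁; fromℕ; fromℕ<)
open import Data.Fin.Properties using (toℕ-inject₁; toℕ-fromℕ; toℕ<n; toℕ-fromℕ<)
open import Data.Integer as ℤ using (ℤ; +_; 0ℤ; 1ℤ; -1ℤ)
import Data.Integer.Properties as ℤ
open import Data.Integer.Tactic.RingSolver using (solve-∀)
open import Data.List as List using (List; []; _∷_; _++_; length; map; foldr)
open import Data.List.Properties using (length-++; length-replicate; length-map; map-++; map-∘)
open import Data.List.Membership.Propositional using (_∈_)
open import Data.List.Membership.Propositional.Properties using (∈-∃++)
open import Data.List.Relation.Binary.Sublist.Propositional using (_⊆_; []; _∷_; _∷ʳ_; minimum)
open import Data.List.Relation.Binary.Sublist.Propositional.Properties using (All-resp-⊆)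
open import Data.List.Relation.Unary.All using (All; []; _∷_)
open import Data.List.Relation.Unary.All.Properties using (++⁺; replicate⁺; gmap⁺)
open import Data.Nat as ℕ using (ℕ; zero; suc; pred; _≤_; _<_; z≤n; s≤s; NonZero)
open import Data.Nat.Combinatorics using (_C_; nCk+nC[k+1]≡[n+1]C[k+1]; nC1≡n; nCn≡1)
open import Data.Nat.Divisibility
  using ( _∣_; _∣?_; divides; quotient; ∣⇒≤; ∣-refl; ∣-trans; _∣0; 1∣_; m∣m*n; ∣m∣n⇒∣m+n; ∣m+n∣m⇒∣n
        ; ∣1⇒≡1; *-monoʳ-∣; *-cancelˡ-∣)
open import Data.Nat.ListAction using (sum)
open import Data.Nat.ListAction.Properties using (sum-++)
open import Data.Nat.Primality
  using (Prime; euclidsLemma; prime⇒irreducible; prime⇒nonZero; prime⇒nonTrivial)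
open import Data.Nat.Properties
  using ( ≤-refl; ≤-reflexive; ≤-trans; <-trans; <-irrefl; ≤-<-trans; <-≤-trans; ≤-pred; ≮⇒≥; <⇒≱
        ; m<n⇒m<1+n; m≤m+n; m≤n+m; +-monoʳ-≤; suc-pred; m^n≢0; +-0-isCommutativeMonoid
        ; +-assoc; +-comm; +-identityˡ; +-identityʳ; *-comm; *-assoc; *-identityˡ; *-identityʳ; *-zeroʳ)
import Data.Nat.Tactic.RingSolver as ℕ-Solver
open import Data.Product using (∃; _,_)
open import Data.Sum using (_⊎_; inj₁; inj₂)
open import Data.Vec as Vec using (Vec; _∷_; zipWith; head; tail; lookup; tabulate; replicate)
open import Data.Vec.Functional using (Vector)
open import Data.Vec.Properties
  using ( zipWith-assoc; zipWith-comm; zipWith-identityˡ; zipWith-identityʳ; lookup-zipWith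
        ; lookup∘tabulate; lookup-replicate; tabulate-cong; tabulate∘lookup)
open import Function using (_∘_; mk⇔)
open import Relation.Binary.Bundles using (Setoid)
open import Relation.Binary.PropositionalEquality
open import Relation.Nullary using (¬_; does; yes; no; contradiction)
open import Relation.Nullary.Decidable using (does-⇔; dec-true)
import Relation.Binary.Reasoning.Setoid as SetoidReasoning
open import Algebra.Properties.Monoid.Sum ℤ.+-0-monoid
  using (sum-syntax; sum-cong-≗; sum-replicate-zero; sum-init-last) renaming (sum to ∑)

open import Defs

module _ where
  open import Data.Nat using (_+_; _*_)

  C-absorption : ∀ n k → suc k * (suc n C suc k) ≡ suc n * (n C k)
  C-absorption n       zero    =
    trans (*-identityˡ (suc n C 1)) (trans (nC1≡n (suc n)) (sym (*-identityʳ (suc n))))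
  C-absorption zero    (suc k) = *-zeroʳ (suc (suc k))
  C-absorption (suc n) (suc k) = begin
    suc (suc k) * (suc (suc n) C suc (suc k))
      ≡⟨ cong (suc (suc k) *_) (sym (nCk+nC[k+1]≡[n+1]C[k+1] (suc n) (suc k))) ⟩
    suc (suc k) * (suc n C suc k + suc n C suc (suc k))
      ≡⟨ regroup k (suc n C suc k) (suc n C suc (suc k)) ⟩
    suc n C suc k + (suc k * (suc n C suc k) + suc (suc k) * (suc n C suc (suc k)))
      ≡⟨ cong₂ (λ u v → suc n C suc k + (u + v)) (C-absorption n k) (C-absorption n (suc k)) ⟩
    suc n C suc k + (suc n * (n C k) + suc n * (n C suc k))
      ≡⟨ cong (_+ (suc n * (n C k) + suc n * (n C suc k))) (sym (nCk+nC[k+1]≡[n+1]C[k+1] n k)) ⟩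
    n C k + n C suc k + (suc n * (n C k) + suc n * (n C suc k))
      ≡⟨ collect n (n C k) (n C suc k) ⟩
    suc (suc n) * (n C k + n C suc k)
      ≡⟨ cong (suc (suc n) *_) (nCk+nC[k+1]≡[n+1]C[k+1] n k) ⟩
    suc (suc n) * (suc n C suc k)
      ∎
    where
      open ≡-Reasoning
      regroup : ∀ k a b → suc (suc k) * (a + b) ≡ a + (suc k * a + suc (suc k) * b)
      regroup = ℕ-Solver.solve-∀
      collect : ∀ n a b → a + b + (suc n * a + suc n * b) ≡ suc (suc n) * (a + b)
      collect = ℕ-Solver.solve-∀

  prime∣C : ∀ {p k} → Prime p → 0 < k → k < p → p ∣ p C k
  prime∣C {suc n} {suc k} p-prime _ k<p
    with euclidsLemma (suc k) (suc n C suc k) p-prime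
           (divides (n C k) (trans (C-absorption n k) (*-comm (suc n) (n C k))))
  ... | inj₁ p∣1+k = contradiction (∣⇒≤ p∣1+k) (<⇒≱ k<p)
  ... | inj₂ p∣C   = p∣C

module _ where
  open import Data.Integer using (_+_; _-_; _^_)
  open import Data.Product using (_×_)

  sum-sub : ∀ {n} (a b : Vector ℤ n) → ∑[ j < n ] (a j - b j) ≡ ∑ a - ∑ b
  sum-sub {zero}  a b = refl
  sum-sub {suc n} a b = trans (cong (_+_ (a zero - b zero)) (sum-sub (a ∘ suc) (b ∘ suc)))
                              (identity (a zero) (b zero) (∑ (a ∘ suc)) (∑ (b ∘ suc)))
    where identity : ∀ a b c d → (a - b) + (c - d) ≡ (a + c) - (b + d)
          identity = solve-∀

  -1^-parity : ∀ n → (-1ℤ ^ n ≡ -1ℤ × 2 ∣ suc n) ⊎ (-1ℤ ^ n ≡ 1ℤ × 2 ∣ n)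
  -1^-parity zero = inj₂ (refl , 2 ∣0)
  -1^-parity (suc n) with -1^-parity n
  ... | inj₁ (odd  , 2∣1+n) rewrite odd  = inj₂ (refl , 2∣1+n)
  ... | inj₂ (even , 2∣n)   rewrite even = inj₁ (refl , ∣m∣n⇒∣m+n (∣-refl {2}) 2∣n)

module Congruence (m : ℕ) where
  open import Data.Integer using (_+_; _-_; _*_; -_; _^_)
  import Data.Integer.Divisibility.Signed as Signed

  infix 4 _≈_
  record _≈_ (a b : ℤ) : Set where
    constructor ≈-intro
    field ∣-difference : + m Signed.∣ a - b

  private
    ≈-via : ∀ {a b c} → a - b ≡ c → + m Signed.∣ c → a ≈ b
    ≈-via a-b≡c m∣c = ≈-intro (subst (+ m Signed.∣_) (sym a-b≡c) m∣c)

  ≈-reflexive : ∀ {a b} → a ≡ b → a ≈ b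
  ≈-reflexive {a} refl = ≈-via (ℤ.+-inverseʳ a) (Signed.divides 0ℤ refl)

  ≈-sym : ∀ {a b} → a ≈ b → b ≈ a
  ≈-sym {a} {b} (≈-intro m∣a-b) = ≈-via (identity a b) (Signed.∣m⇒∣-m m∣a-b)
    where identity : ∀ a b → b - a ≡ - (a - b)
          identity = solve-∀

  ≈-trans : ∀ {a b c} → a ≈ b → b ≈ c → a ≈ c
  ≈-trans {a} {b} {c} (≈-intro m∣a-b) (≈-intro m∣b-c) =
    ≈-via (identity a b c) (Signed.∣m∣n⇒∣m+n m∣a-b m∣b-c)
    where identity : ∀ a b c → a - c ≡ (a - b) + (b - c)
          identity = solve-∀

  ≈-setoid : Setoid 0ℓ 0ℓ
  ≈-setoid = record
    { Carrier       = ℤ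
    ; _≈_           = _≈_
    ; isEquivalence = record { refl = ≈-reflexive refl ; sym = ≈-sym ; trans = ≈-trans }
    }

  module ≈-Reasoning = SetoidReasoning ≈-setoid

  +-cong : ∀ {a b c d} → a ≈ b → c ≈ d → a + c ≈ b + d
  +-cong {a} {b} {c} {d} (≈-intro m∣a-b) (≈-intro m∣c-d) =
    ≈-via (identity a b c d) (Signed.∣m∣n⇒∣m+n m∣a-b m∣c-d)
    where identity : ∀ a b c d → (a + c) - (b + d) ≡ (a - b) + (c - d)
          identity = solve-∀

  difference-cong : ∀ {a b c d} → a ≈ b → c ≈ d → a - c ≈ b - d
  difference-cong {a} {b} {c} {d} (≈-intro m∣a-b) (≈-intro m∣c-d) =
    ≈-via (identity a b c d) (Signed.∣m∣n⇒∣m-n m∣a-b m∣c-d)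
    where identity : ∀ a b c d → (a - c) - (b - d) ≡ (a - b) - (c - d)
          identity = solve-∀

  *-congˡ : ∀ c {a b} → a ≈ b → c * a ≈ c * b
  *-congˡ c {a} {b} (≈-intro m∣a-b) = ≈-via (identity c a b) (Signed.∣n⇒∣m*n c m∣a-b)
    where identity : ∀ c a b → c * a - c * b ≡ c * (a - b)
          identity = solve-∀

  *-congʳ : ∀ c {a b} → a ≈ b → a * c ≈ b * c
  *-congʳ c {a} {b} (≈-intro m∣a-b) = ≈-via (identity c a b) (Signed.∣n⇒∣m*n c m∣a-b)
    where identity : ∀ c a b → a * c - b * c ≡ c * (a - b)
          identity = solve-∀

  ∣⇒≈0 : ∀ {n} → m ∣ n → + n ≈ 0ℤ
  ∣⇒≈0 (divides q refl) =
    ≈-intro (Signed.divides (+ q) (trans (ℤ.+-identityʳ (+ (q ℕ.* m))) (ℤ.pos-* q m)))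

  sum-≈0 : ∀ {n} (t : Vector ℤ n) → (∀ j → t j ≈ 0ℤ) → ∑ t ≈ 0ℤ
  sum-≈0 {zero}  t _   = ≈-reflexive refl
  sum-≈0 {suc n} t t≈0 = +-cong (t≈0 zero) (sum-≈0 (t ∘ suc) (t≈0 ∘ suc))

  -1^m≈-1 : Prime m → -1ℤ ^ m ≈ -1ℤ
  -1^m≈-1 m-prime with -1^-parity m
  ... | inj₁ (odd , _)   = ≈-reflexive odd
  ... | inj₂ (even , 2∣m) with prime⇒irreducible m-prime 2∣m
  ...   | inj₂ refl = ≈-intro (Signed.divides 1ℤ (cong (_- -1ℤ) even))

  1≉0 : Prime m → ¬ (1ℤ ≈ 0ℤ)
  1≉0 m-prime (≈-intro m∣1) =
    <-irrefl (sym (∣1⇒≡1 (Signed.∣⇒∣ᵤ m∣1))) (ℕ.nonTrivial⇒n>1 m {{prime⇒nonTrivial m-prime}})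

module FiniteDifferences {A : Set} {_∙_ : Op₂ A} {ε : A}
                         (isCommutativeMonoid : IsCommutativeMonoid _≡_ _∙_ ε) where
  open import Data.Integer using (_+_; _-_; _*_; -_; _^_)

  private
    commutativeMonoid : CommutativeMonoid 0ℓ 0ℓ
    commutativeMonoid = record { isCommutativeMonoid = isCommutativeMonoid }
  open CommutativeMonoid commutativeMonoid using (assoc; identityʳ; commutativeSemigroup; rawMonoid; monoid)
  open import Algebra.Definitions.RawMonoid rawMonoid using (_×_) public
  open import Algebra.Properties.Monoid.Mult monoid using (×-assocˡ)
  open import Algebra.Properties.CommutativeSemigroup commutativeSemigroup using (xy∙z≈xz∙y; xy∙z≈x∙zy)

  Δ : A → (A → ℤ) → A → ℤ
  Δ s f x = f x - f (x ∙ s)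

  Δ* : List A → (A → ℤ) → A → ℤ
  Δ* []      f = f
  Δ* (s ∷ L) f = Δ* L (Δ s f)

  Δ*-++ : ∀ L M f → Δ* (L ++ M) f ≡ Δ* M (Δ* L f)
  Δ*-++ []      M f = refl
  Δ*-++ (s ∷ L) M f = Δ*-++ L M (Δ s f)

  Δ*-replicate-+ : ∀ N M s f →
                   Δ* (List.replicate (N ℕ.+ M) s) f ≡ Δ* (List.replicate M s) (Δ* (List.replicate N s) f)
  Δ*-replicate-+ zero    M s f = refl
  Δ*-replicate-+ (suc N) M s f = Δ*-replicate-+ N M s (Δ s f)

  Δ*-cong : ∀ L {f g} → f ≗ g → Δ* L f ≗ Δ* L g
  Δ*-cong []      f≗g = f≗g
  Δ*-cong (s ∷ L) f≗g = Δ*-cong L (λ x → cong₂ _-_ (f≗g x) (f≗g (x ∙ s)))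

  Δ*-shift : ∀ L f t x → Δ* L (λ y → f (y ∙ t)) x ≡ Δ* L f (x ∙ t)
  Δ*-shift []      f t x = refl
  Δ*-shift (s ∷ L) f t x =
    trans (Δ*-cong L (λ y → cong (λ z → f (y ∙ t) - f z) (xy∙z≈xz∙y y s t)) x) (Δ*-shift L (Δ s f) t x)

  Δ-comm : ∀ s t f x → Δ s (Δ t f) x ≡ Δ t (Δ s f) x
  Δ-comm s t f x rewrite xy∙z≈xz∙y x s t = identity (f x) (f (x ∙ t)) (f (x ∙ s)) (f ((x ∙ t) ∙ s))
    where identity : ∀ a b c d → (a - b) - (c - d) ≡ (a - c) - (b - d)
          identity = solve-∀

  Δ*-Δ : ∀ L s f x → Δ* L (Δ s f) x ≡ Δ s (Δ* L f) x
  Δ*-Δ []      s f x = refl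
  Δ*-Δ (t ∷ L) s f x = trans (Δ*-cong L (Δ-comm t s f) x) (Δ*-Δ L s (Δ t f) x)

  Δ*-+ : ∀ L f g x → Δ* L (λ y → f y + g y) x ≡ Δ* L f x + Δ* L g x
  Δ*-+ []      f g x = refl
  Δ*-+ (s ∷ L) f g x =
    trans (Δ*-cong L (λ y → identity (f y) (g y) (f (y ∙ s)) (g (y ∙ s))) x) (Δ*-+ L (Δ s f) (Δ s g) x)
    where identity : ∀ a b c d → (a + b) - (c + d) ≡ (a - c) + (b - d)
          identity = solve-∀

  Δ-∙ : ∀ s t f x → Δ (s ∙ t) f x ≡ Δ s f x + Δ t f (x ∙ s)
  Δ-∙ s t f x rewrite sym (assoc x s t) = identity (f x) (f (x ∙ s)) (f ((x ∙ s) ∙ t))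
    where identity : ∀ a b c → a - c ≡ (a - b) + (b - c)
          identity = solve-∀

  Δ-ε : ∀ f x → Δ ε f x ≡ 0ℤ
  Δ-ε f x rewrite identityʳ x = ℤ.+-inverseʳ (f x)

  Δ-* : ∀ s f g x → Δ s (λ y → f y * g y) x ≡ Δ s f x * g x + f (x ∙ s) * Δ s g x
  Δ-* s f g x = identity (f x) (g x) (f (x ∙ s)) (g (x ∙ s))
    where identity : ∀ a b c d → a * b - c * d ≡ (a - c) * b + c * (b - d)
          identity = solve-∀

  Δ*-replicate : ∀ n M → n < M → ∀ s f x →
                 Δ* (List.replicate n s) f x ≡ ∑[ j < M ] (-1ℤ ^ toℕ j * + (n C toℕ j) * f (x ∙ (toℕ j × s)))
  Δ*-replicate zero (suc M) _ s f x = begin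
    f x                                      ≡⟨ cong f (identityʳ x) ⟨
    f (x ∙ ε)                                ≡⟨ identity (f (x ∙ ε)) ⟩
    + 1 * + 1 * f (x ∙ ε) + 0ℤ               ≡⟨ cong (_+_ (+ 1 * + 1 * f (x ∙ ε))) (sum-replicate-zero M) ⟨
    + 1 * + 1 * f (x ∙ ε) + ∑[ j < M ] 0ℤ    ≡⟨ cong (_+_ (+ 1 * + 1 * f (x ∙ ε))) (sum-cong-≗ {M} vanish) ⟨
    ∑[ j < suc M ] (-1ℤ ^ toℕ j * + (0 C toℕ j) * f (x ∙ (toℕ j × s))) ∎
    where
      open ≡-Reasoning
      identity : ∀ a → a ≡ + 1 * + 1 * a + 0ℤ
      identity = solve-∀
      vanish : ∀ j → -1ℤ ^ suc (toℕ j) * + 0 * f (x ∙ (suc (toℕ j) × s)) ≡ 0ℤ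
      vanish j rewrite ℤ.*-zeroʳ (-1ℤ ^ suc (toℕ j)) = ℤ.*-zeroˡ (f (x ∙ (suc (toℕ j) × s)))
  Δ*-replicate (suc n) (suc M) (s≤s n<M) s f x = begin
    Δ* (List.replicate n s) (Δ s f) x
      ≡⟨ Δ*-Δ (List.replicate n s) s f x ⟩
    Δ* (List.replicate n s) f x - Δ* (List.replicate n s) f (x ∙ s)
      ≡⟨ cong₂ _-_ (Δ*-replicate n (suc M) (m<n⇒m<1+n n<M) s f x) (Δ*-replicate n M n<M s f (x ∙ s)) ⟩
    (t n x 0 + ∑[ j < M ] t n x (suc (toℕ j))) - ∑[ j < M ] t n (x ∙ s) (toℕ j)
      ≡⟨ identity (t n x 0) _ _ ⟩
    t n x 0 + (∑[ j < M ] t n x (suc (toℕ j)) - ∑[ j < M ] t n (x ∙ s) (toℕ j))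
      ≡⟨ cong (_+_ (t n x 0)) (sum-sub {M} (t n x ∘ suc ∘ toℕ) (t n (x ∙ s) ∘ toℕ)) ⟨
    t n x 0 + ∑[ j < M ] (t n x (suc (toℕ j)) - t n (x ∙ s) (toℕ j))
      ≡⟨ cong (_+_ (t n x 0)) (sum-cong-≗ {M} (pascal ∘ toℕ)) ⟩
    t (suc n) x 0 + ∑[ j < M ] t (suc n) x (suc (toℕ j))
      ∎
    where
      open ≡-Reasoning
      t : ℕ → A → ℕ → ℤ
      t n x j = -1ℤ ^ j * + (n C j) * f (x ∙ (j × s))
      identity : ∀ a b c → (a + b) - c ≡ a + (b - c)
      identity = solve-∀
      pascal : ∀ k → t n x (suc k) - t n (x ∙ s) k ≡ t (suc n) x (suc k)
      pascal k
        rewrite assoc x s (k × s) | sym (nCk+nC[k+1]≡[n+1]C[k+1] n k) | ℤ.pos-+ (n C k) (n C suc k)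
              | ℤ.-1*i≡-i (-1ℤ ^ k)
        = signedPascal (-1ℤ ^ k) (+ (n C k)) (+ (n C suc k)) (f (x ∙ (s ∙ (k × s))))
        where signedPascal : ∀ e a b F → (- e) * b * F - e * a * F ≡ (- e) * (a + b) * F
              signedPascal = solve-∀

  Δ*-subsums-vanish : ∀ {B : Set} (v : B → A) S f x →
                      (∀ T → T ⊆ S → T ≢ [] → f (x ∙ foldr _∙_ ε (map v T)) ≡ 0ℤ) →
                      Δ* (map v S) f x ≡ f x
  Δ*-subsums-vanish v []      f x _        = refl
  Δ*-subsums-vanish v (b ∷ S) f x vanishes = begin
    Δ* (map v S) (Δ (v b) f) x  ≡⟨ Δ*-subsums-vanish v S (Δ (v b) f) x Δf-vanishes ⟩
    f x - f (x ∙ v b)           ≡⟨ cong (λ y → f x - f (x ∙ y)) (identityʳ (v b)) ⟨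
    f x - f (x ∙ (v b ∙ ε))     ≡⟨ cong (_-_ (f x)) (vanishes (b ∷ []) (refl ∷ minimum S) (λ ())) ⟩
    f x - 0ℤ                    ≡⟨ ℤ.+-identityʳ (f x) ⟩
    f x                         ∎
    where
      open ≡-Reasoning
      Δf-vanishes : ∀ T → T ⊆ S → T ≢ [] → Δ (v b) f (x ∙ foldr _∙_ ε (map v T)) ≡ 0ℤ
      Δf-vanishes T T⊆S T≢[] = cong₂ _-_ (vanishes T (b ∷ʳ T⊆S) T≢[])
        (trans (cong f (xy∙z≈x∙zy x _ (v b))) (vanishes (b ∷ T) (refl ∷ T⊆S) (λ ())))

  module Modulo (m : ℕ) where
    open Congruence m

    Δ*-cong-≈ : ∀ L {f g} → (∀ y → f y ≈ g y) → ∀ x → Δ* L f x ≈ Δ* L g x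
    Δ*-cong-≈ []      f≈g = f≈g
    Δ*-cong-≈ (s ∷ L) f≈g = Δ*-cong-≈ L (λ y → difference-cong (f≈g y) (f≈g (y ∙ s)))

    Δ*-≈0 : ∀ L {f} → (∀ y → f y ≈ 0ℤ) → ∀ x → Δ* L f x ≈ 0ℤ
    Δ*-≈0 []      f≈0 = f≈0
    Δ*-≈0 (s ∷ L) f≈0 = Δ*-≈0 L (λ y → difference-cong (f≈0 y) (f≈0 (y ∙ s)))

    Deg< : ℕ → (A → ℤ) → Set
    Deg< n f = ∀ L → n ≤ length L → ∀ x → Δ* L f x ≈ 0ℤ

    Deg<⇒≈0 : ∀ {f} → Deg< 0 f → ∀ x → f x ≈ 0ℤ
    Deg<⇒≈0 deg = deg [] z≤n

    ≈0⇒Deg< : ∀ {n f} → (∀ x → f x ≈ 0ℤ) → Deg< n f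
    ≈0⇒Deg< f≈0 L _ = Δ*-≈0 L f≈0

    Deg<-const : ∀ c → Deg< 1 (λ _ → c)
    Deg<-const c (s ∷ L) _ = Δ*-≈0 L (λ _ → ≈-reflexive (ℤ.+-inverseʳ c))

    Deg<-≤ : ∀ {n n′ f} → n ≤ n′ → Deg< n f → Deg< n′ f
    Deg<-≤ n≤n′ deg L n′≤∣L∣ = deg L (≤-trans n≤n′ n′≤∣L∣)

    Deg<-resp-≈ : ∀ {n f g} → (∀ x → f x ≈ g x) → Deg< n f → Deg< n g
    Deg<-resp-≈ f≈g deg L n≤∣L∣ x = ≈-trans (≈-sym (Δ*-cong-≈ L f≈g x)) (deg L n≤∣L∣ x)

    Deg<-Δ* : ∀ L {n f} → Deg< (length L ℕ.+ n) f → Deg< n (Δ* L f)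
    Deg<-Δ* L {f = f} deg M n≤∣M∣ x = subst (λ g → g x ≈ 0ℤ) (Δ*-++ L M f)
      (deg (L ++ M) (subst (length L ℕ.+ _ ≤_) (sym (length-++ L)) (+-monoʳ-≤ (length L) n≤∣M∣)) x)

    Deg<-Δ : ∀ s {n f} → Deg< (suc n) f → Deg< n (Δ s f)
    Deg<-Δ s = Deg<-Δ* (s ∷ [])

    Deg<-shift : ∀ t {n f} → Deg< n f → Deg< n (λ x → f (x ∙ t))
    Deg<-shift t {f = f} deg L n≤∣L∣ x =
      subst (_≈ 0ℤ) (sym (Δ*-shift L f t x)) (deg L n≤∣L∣ (x ∙ t))

    mutual
      Deg<-* : ∀ {a b f g} → Deg< (suc a) f → Deg< (suc b) g → Deg< (suc (a ℕ.+ b)) (λ x → f x * g x)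
      Deg<-* {a} {b} {f} {g} deg-f deg-g (s ∷ L) (s≤s a+b≤∣L∣) x = begin
        Δ* L (Δ s (λ y → f y * g y)) x
          ≡⟨ Δ*-cong L (Δ-* s f g) x ⟩
        Δ* L (λ y → Δ s f y * g y + f (y ∙ s) * Δ s g y) x
          ≡⟨ Δ*-+ L _ _ x ⟩
        Δ* L (λ y → Δ s f y * g y) x + Δ* L (λ y → f (y ∙ s) * Δ s g y) x
          ≡⟨ cong (_+_ (Δ* L (λ y → Δ s f y * g y) x))
                  (Δ*-cong L (λ y → ℤ.*-comm (f (y ∙ s)) (Δ s g y)) x) ⟩
        Δ* L (λ y → Δ s f y * g y) x + Δ* L (λ y → Δ s g y * f (y ∙ s)) x
          ≈⟨ +-cong (Deg<-*′ (Deg<-Δ s deg-f) deg-g L a+b≤∣L∣ x)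
                    (Deg<-*′ (Deg<-Δ s deg-g) (Deg<-shift s deg-f) L b+a≤∣L∣ x) ⟩
        0ℤ ∎
        where
          open ≈-Reasoning
          b+a≤∣L∣ = subst (_≤ length L) (+-comm a b) a+b≤∣L∣

      Deg<-*′ : ∀ {a b f g} → Deg< a f → Deg< (suc b) g → Deg< (a ℕ.+ b) (λ x → f x * g x)
      Deg<-*′ {zero}  {g = g} deg-f deg-g   = ≈0⇒Deg< (λ x → *-congʳ (g x) (Deg<⇒≈0 deg-f x))
      Deg<-*′ {suc a}         deg-f deg-g L = Deg<-* deg-f deg-g L

    Δ-×-≈0 : ∀ e {g} → (∀ y → Δ e g y ≈ 0ℤ) → ∀ j x → Δ (j × e) g x ≈ 0ℤ
    Δ-×-≈0 e {g} Δg≈0 zero    x = ≈-reflexive (Δ-ε g x)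
    Δ-×-≈0 e {g} Δg≈0 (suc j) x =
      ≈-trans (≈-reflexive (Δ-∙ e (j × e) g x)) (+-cong (Δg≈0 x) (Δ-×-≈0 e {g} Δg≈0 j (x ∙ e)))

    -- When e generates A, every difference operator telescopes into differences along e.
    Deg<-generated : ∀ e → (∀ s → ∃ λ j → s ≡ j × e) →
                     ∀ {n f} → (∀ x → Δ* (List.replicate n e) f x ≈ 0ℤ) → Deg< n f
    Deg<-generated e generates {zero}  eⁿf≈0 L _ = Δ*-≈0 L eⁿf≈0
    Deg<-generated e generates {suc n} {f} eⁿf≈0 (s ∷ L) (s≤s n≤∣L∣) =
      Deg<-generated e generates {n} {Δ s f} eⁿΔf≈0 L n≤∣L∣
      where
        eⁿΔf≈0 : ∀ x → Δ* (List.replicate n e) (Δ s f) x ≈ 0ℤ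
        eⁿΔf≈0 x with generates s
        ... | j , refl = ≈-trans (≈-reflexive (Δ*-Δ (List.replicate n e) (j × e) f x))
          (Δ-×-≈0 e {Δ* (List.replicate n e) f}
            (λ y → ≈-trans (≈-reflexive (sym (Δ*-Δ (List.replicate n e) e f y))) (eⁿf≈0 y)) j x)

    Δ*-replicate-≈ : ∀ n → 0 < n → (∀ j → 0 < j → j < n → m ∣ n C j) → -1ℤ ^ n ≈ -1ℤ →
                     ∀ s f x → Δ* (List.replicate n s) f x ≈ Δ (n × s) f x
    Δ*-replicate-≈ (suc q) _ m∣C sign s f x = begin
      Δ* (List.replicate (suc q) s) f x
        ≡⟨ Δ*-replicate (suc q) (suc (suc q)) ≤-refl s f x ⟩
      T 0 + ∑[ j < suc q ] T (suc (toℕ j))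
        ≡⟨ cong (_+_ (T 0)) (sum-init-last {q} (λ j → T (suc (toℕ j)))) ⟩
      T 0 + (∑[ j < q ] T (suc (toℕ (inject₁ j))) + T (suc (toℕ (fromℕ q))))
        ≈⟨ +-cong (≈-reflexive T₀) (+-cong (sum-≈0 {q} _ middle) last) ⟩
      f x + (0ℤ + -1ℤ * f (x ∙ (suc q × s)))
        ≡⟨ identity (f x) (f (x ∙ (suc q × s))) ⟩
      Δ (suc q × s) f x ∎
      where
        open ≈-Reasoning
        T : ℕ → ℤ
        T k = -1ℤ ^ k * + (suc q C k) * f (x ∙ (k × s))
        T₀ : T 0 ≡ f x
        T₀ = trans (ℤ.*-identityˡ (f (x ∙ ε))) (cong f (identityʳ x))
        middle : ∀ j → T (suc (toℕ (inject₁ j))) ≈ 0ℤ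
        middle j = ≈-trans
          (*-congʳ (f (x ∙ (k × s))) (*-congˡ (-1ℤ ^ k) (∣⇒≈0 (m∣C k (s≤s z≤n) k<1+q))))
          (≈-reflexive (cong (_* f (x ∙ (k × s))) (ℤ.*-zeroʳ (-1ℤ ^ k))))
          where k = suc (toℕ (inject₁ j))
                k<1+q = s≤s (subst (_< q) (sym (toℕ-inject₁ j)) (toℕ<n j))
        last : T (suc (toℕ (fromℕ q))) ≈ -1ℤ * f (x ∙ (suc q × s))
        last rewrite toℕ-fromℕ q | nCn≡1 (suc q) =
          *-congʳ (f (x ∙ (suc q × s))) (≈-trans (≈-reflexive (ℤ.*-identityʳ (-1ℤ ^ suc q))) sign)
        identity : ∀ a b → a + (0ℤ + -1ℤ * b) ≡ a - b
        identity = solve-∀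

    frobenius : Prime m → ∀ s f x → Δ* (List.replicate m s) f x ≈ Δ (m × s) f x
    frobenius m-prime = Δ*-replicate-≈ m (ℕ.>-nonZero⁻¹ m {{prime⇒nonZero m-prime}})
                          (λ j 0<j j<m → prime∣C m-prime 0<j j<m) (-1^m≈-1 m-prime)

    Deg<-Δ-× : Prime m → ∀ s {n f} → Deg< (m ℕ.+ n) f → Deg< n (Δ (m × s) f)
    Deg<-Δ-× m-prime s {n} {f} deg = Deg<-resp-≈ (frobenius m-prime s f)
      (Deg<-Δ* (List.replicate m s) (subst (λ l → Deg< (l ℕ.+ n) f) (sym (length-replicate m)) deg))

    Deg<-Δ*-× : Prime m → ∀ L₁ s L₂ {n f} → Deg< (length L₁ ℕ.+ (m ℕ.+ (length L₂ ℕ.+ n))) f →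
                Deg< n (Δ* (L₁ ++ m × s ∷ L₂) f)
    Deg<-Δ*-× m-prime L₁ s L₂ {f = f} deg rewrite Δ*-++ L₁ (m × s ∷ L₂) f =
      Deg<-Δ* L₂ (Deg<-Δ-× m-prime s (Deg<-Δ* L₁ deg))

    Δ*-replicate-* : ∀ {N s t} → (∀ g y → Δ* (List.replicate N s) g y ≈ Δ t g y) →
                     ∀ a f x → Δ* (List.replicate (a ℕ.* N) s) f x ≈ Δ* (List.replicate a t) f x
    Δ*-replicate-* hyp zero    f x = ≈-reflexive refl
    Δ*-replicate-* {N} {s} {t} hyp (suc a) f x = begin
      Δ* (List.replicate (N ℕ.+ a ℕ.* N) s) f x
        ≡⟨ cong (λ g → g x) (Δ*-replicate-+ N (a ℕ.* N) s f) ⟩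
      Δ* (List.replicate (a ℕ.* N) s) (Δ* (List.replicate N s) f) x
        ≈⟨ Δ*-replicate-* hyp a _ x ⟩
      Δ* (List.replicate a t) (Δ* (List.replicate N s) f) x
        ≈⟨ Δ*-cong-≈ (List.replicate a t) (hyp f) x ⟩
      Δ* (List.replicate (suc a) t) f x ∎
      where open ≈-Reasoning

    frobenius-^ : Prime m → ∀ e s f x →
                  Δ* (List.replicate (m ℕ.^ e) s) f x ≈ Δ ((m ℕ.^ e) × s) f x
    frobenius-^ m-prime zero    s f x = ≈-reflexive (cong (λ t → Δ t f x) (sym (identityʳ s)))
    frobenius-^ m-prime (suc e) s f x = begin
      Δ* (List.replicate (m ℕ.* m ℕ.^ e) s) f x
        ≈⟨ Δ*-replicate-* (frobenius-^ m-prime e s) m f x ⟩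
      Δ* (List.replicate m ((m ℕ.^ e) × s)) f x
        ≈⟨ frobenius m-prime ((m ℕ.^ e) × s) f x ⟩
      Δ (m × ((m ℕ.^ e) × s)) f x
        ≡⟨ cong (λ t → Δ t f x) (×-assocˡ s m (m ℕ.^ e)) ⟩
      Δ ((m ℕ.* m ℕ.^ e) × s) f x ∎
      where open ≈-Reasoning

module Pullback {A B : Set} {_∙ᴬ_ : Op₂ A} {εᴬ : A} {_∙ᴮ_ : Op₂ B} {εᴮ : B}
                (isᴬ : IsCommutativeMonoid _≡_ _∙ᴬ_ εᴬ) (isᴮ : IsCommutativeMonoid _≡_ _∙ᴮ_ εᴮ)
                (π : A → B) (π-∙ : ∀ x y → π (x ∙ᴬ y) ≡ π x ∙ᴮ π y) where
  open import Data.Integer using (_-_)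
  private
    module DA = FiniteDifferences isᴬ
    module DB = FiniteDifferences isᴮ

  Δ*-∘ : ∀ L φ x → DA.Δ* L (φ ∘ π) x ≡ DB.Δ* (map π L) φ (π x)
  Δ*-∘ []      φ x = refl
  Δ*-∘ (s ∷ L) φ x =
    trans (DA.Δ*-cong L (λ y → cong (λ z → φ (π y) - φ z) (π-∙ y s)) x) (Δ*-∘ L (DB.Δ (π s) φ) x)

  Deg<-∘ : ∀ m {n φ} → DB.Modulo.Deg< m n φ → DA.Modulo.Deg< m n (φ ∘ π)
  Deg<-∘ m {φ = φ} deg L n≤∣L∣ x = subst (λ z → Congruence._≈_ m z 0ℤ) (sym (Δ*-∘ L φ x))
    (deg (map π L) (subst (_ ≤_) (sym (length-map π L)) n≤∣L∣) (π x))

open import Data.Nat using (_+_; _*_; _^_)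

𝟙[_∣_] : ℕ → ℕ → ℤ
𝟙[ N ∣ x ] = if does (N ∣? x) then 1ℤ else 0ℤ

𝟙-periodic : ∀ N x → 𝟙[ N ∣ x + N ] ≡ 𝟙[ N ∣ x ]
𝟙-periodic N x = cong (if_then 1ℤ else 0ℤ)
  (does-⇔ (mk⇔ (λ N∣x+N → ∣m+n∣m⇒∣n (subst (N ∣_) (+-comm x N) N∣x+N) ∣-refl)
               (λ N∣x → ∣m∣n⇒∣m+n N∣x ∣-refl))
          (N ∣? (x + N)) (N ∣? x))

prime-power-nonZero : ∀ {p N} → Prime p → (∃ λ e → N ≡ p ^ e) → NonZero N
prime-power-nonZero {p} p-prime (e , refl) = m^n≢0 p e {{prime⇒nonZero p-prime}}

module ℕ-Differences = FiniteDifferences +-0-isCommutativeMonoid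

Deg<-𝟙 : ∀ {p} → Prime p → ∀ {N} → (∃ λ e → N ≡ p ^ e) → ℕ-Differences.Modulo.Deg< p N 𝟙[ N ∣_]
Deg<-𝟙 {p} p-prime (e , refl) = Deg<-generated 1 (λ s → s , sym (s×1≡s s)) Δᴺ𝟙≈0
  where
    open ℕ-Differences
    open Modulo p
    open Congruence p
    N = p ^ e
    s×1≡s : ∀ s → s × 1 ≡ s
    s×1≡s zero    = refl
    s×1≡s (suc s) = cong suc (s×1≡s s)
    Δᴺ𝟙≈0 : ∀ x → Δ* (List.replicate N 1) 𝟙[ N ∣_] x ≈ 0ℤ
    Δᴺ𝟙≈0 x = ≈-trans (frobenius-^ p-prime e 1 𝟙[ N ∣_] x) (≈-reflexive (begin
      𝟙[ N ∣ x ] ℤ.- 𝟙[ N ∣ x + N × 1 ] ≡⟨ cong (λ t → 𝟙[ N ∣ x ] ℤ.- 𝟙[ N ∣ x + t ]) (s×1≡s N) ⟩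
      𝟙[ N ∣ x ] ℤ.- 𝟙[ N ∣ x + N ]     ≡⟨ cong (ℤ._-_ 𝟙[ N ∣ x ]) (𝟙-periodic N x) ⟩
      𝟙[ N ∣ x ] ℤ.- 𝟙[ N ∣ x ]         ≡⟨ ℤ.+-inverseʳ 𝟙[ N ∣ x ] ⟩
      0ℤ                               ∎))
      where open ≡-Reasoning

infixl 6 _⊕_
_⊕_ : ∀ {k} → Vec ℕ k → Vec ℕ k → Vec ℕ k
_⊕_ = zipWith _+_

⊕-isCommutativeMonoid : ∀ k → IsCommutativeMonoid _≡_ (_⊕_ {k}) (replicate k 0)
⊕-isCommutativeMonoid k = record
  { isMonoid = record
    { isSemigroup = record
      { isMagma = record { isEquivalence = isEquivalence ; ∙-cong = cong₂ _⊕_ }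
      ; assoc   = zipWith-assoc +-assoc
      }
    ; identity = zipWith-identityˡ +-identityˡ , zipWith-identityʳ +-identityʳ
    }
  ; comm = zipWith-comm +-comm
  }

module ℕᵏ-Differences (k : ℕ) = FiniteDifferences (⊕-isCommutativeMonoid k)

head-⊕ : ∀ {k} (x y : Vec ℕ (suc k)) → head (x ⊕ y) ≡ head x + head y
head-⊕ (x ∷ xs) (y ∷ ys) = refl

tail-⊕ : ∀ {k} (x y : Vec ℕ (suc k)) → tail (x ⊕ y) ≡ tail x ⊕ tail y
tail-⊕ (x ∷ xs) (y ∷ ys) = refl

zeroIndicator : ∀ {k} → (Fin k → ℕ) → Vec ℕ k → ℤ
zeroIndicator {zero}  ns x = 1ℤ
zeroIndicator {suc k} ns x = 𝟙[ ns zero ∣ head x ] ℤ.* zeroIndicator (ns ∘ suc) (tail x)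

d* : ∀ {k} → (Fin k → ℕ) → ℕ
d* {zero}  ns = 0
d* {suc k} ns = pred (ns zero) + d* (ns ∘ suc)

Deg<-zeroIndicator : ∀ {p} → Prime p → ∀ {k} (ns : Fin k → ℕ) → (∀ i → ∃ λ e → ns i ≡ p ^ e) →
                     ℕᵏ-Differences.Modulo.Deg< k p (suc (d* ns)) (zeroIndicator ns)
Deg<-zeroIndicator {p} p-prime {zero}  ns _        = ℕᵏ-Differences.Modulo.Deg<-const 0 p 1ℤ
Deg<-zeroIndicator {p} p-prime {suc k} ns p-powers = ℕᵏ-Differences.Modulo.Deg<-* (suc k) p
  (Pullback.Deg<-∘ (⊕-isCommutativeMonoid (suc k)) +-0-isCommutativeMonoid head head-⊕ p first-factor)
  (Pullback.Deg<-∘ (⊕-isCommutativeMonoid (suc k)) (⊕-isCommutativeMonoid k) tail tail-⊕ p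
    (Deg<-zeroIndicator p-prime (ns ∘ suc) (p-powers ∘ suc)))
  where
    first-factor : ℕ-Differences.Modulo.Deg< p (suc (pred (ns zero))) 𝟙[ ns zero ∣_]
    first-factor = subst (λ n → ℕ-Differences.Modulo.Deg< p n 𝟙[ ns zero ∣_])
                         (sym (suc-pred (ns zero) {{prime-power-nonZero p-prime (p-powers zero)}}))
                         (Deg<-𝟙 p-prime (p-powers zero))

toVec : ∀ {k} {ns : Fin k → ℕ} → Elem ns → Vec ℕ k
toVec g = tabulate (toℕ ∘ g)

σ : ∀ {k} {ns : Fin k → ℕ} → Fin k → Seq ns → ℕ
σ i T = sum (map (λ g → toℕ (g i)) T)

lookup-∑-toVec : ∀ {k} {ns : Fin k → ℕ} (T : Seq ns) i →
                 lookup (foldr _⊕_ (replicate k 0) (map toVec T)) i ≡ σ i T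
lookup-∑-toVec []      i = lookup-replicate i 0
lookup-∑-toVec (g ∷ T) i =
  trans (lookup-zipWith _+_ i (toVec g) _) (cong₂ _+_ (lookup∘tabulate (toℕ ∘ g) i) (lookup-∑-toVec T i))

zeroIndicator-0 : ∀ {k} (ns : Fin k → ℕ) → zeroIndicator ns (replicate k 0) ≡ 1ℤ
zeroIndicator-0 {zero}  ns = refl
zeroIndicator-0 {suc k} ns rewrite dec-true (ns zero ∣? 0) (ns zero ∣0) | zeroIndicator-0 (ns ∘ suc) = refl

zeroIndicator-≢0 : ∀ {k} (ns : Fin k → ℕ) x → ¬ (∀ i → ns i ∣ lookup x i) → zeroIndicator ns x ≡ 0ℤ
zeroIndicator-≢0 {zero}  ns Vec.[] x≢0 = contradiction (λ ()) x≢0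
zeroIndicator-≢0 {suc k} ns (y ∷ ys) x≢0 with ns zero ∣? y
... | no  _     = refl
... | yes n₀∣y rewrite zeroIndicator-≢0 (ns ∘ suc) ys (λ ys≡0 → x≢0 λ { zero → n₀∣y ; (suc i) → ys≡0 i })
  = refl

Δ*-zeroIndicator : ∀ {k} (ns : Fin k → ℕ) S → ZeroSumFree ns S →
                   ℕᵏ-Differences.Δ* k (map toVec S) (zeroIndicator ns) (replicate k 0) ≡ 1ℤ
Δ*-zeroIndicator {k} ns S zsf =
  trans (ℕᵏ-Differences.Δ*-subsums-vanish k toVec S (zeroIndicator ns) (replicate k 0) subsums-nonzero)
        (zeroIndicator-0 ns)
  where
    subsums-nonzero : ∀ T → T ⊆ S → T ≢ [] →
                      zeroIndicator ns (replicate k 0 ⊕ foldr _⊕_ (replicate k 0) (map toVec T)) ≡ 0ℤ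
    subsums-nonzero T T⊆S T≢[] = zeroIndicator-≢0 ns _ (λ T≡0 → zsf T T⊆S T≢[] (λ i →
      subst (ns i ∣_) (trans (cong (λ v → lookup v i) (zipWith-identityˡ +-identityˡ _)) (lookup-∑-toVec T i))
            (T≡0 i)))

sum-map-⊆ : ∀ {A : Set} (f : A → ℕ) {T S} → T ⊆ S → sum (map f T) ≤ sum (map f S)
sum-map-⊆ f []           = z≤n
sum-map-⊆ f (y ∷ʳ T⊆S)   = ≤-trans (sum-map-⊆ f T⊆S) (m≤n+m _ (f y))
sum-map-⊆ f (refl ∷ T⊆S) = +-monoʳ-≤ _ (sum-map-⊆ f T⊆S)

NonZeroElem : ∀ {k} {ns : Fin k → ℕ} → Elem ns → Set
NonZeroElem g = ∃ λ i → 0 < toℕ (g i)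

σ<⇒zeroSumFree : ∀ {k} {ns : Fin k → ℕ} (S : Seq ns) → All NonZeroElem S → (∀ i → σ i S < ns i) →
                 ZeroSumFree ns S
σ<⇒zeroSumFree S nonzero σ< []      _   []≢[] _ = []≢[] refl
σ<⇒zeroSumFree S nonzero σ< (t ∷ T) T⊆S _ t∷T≡0 with All-resp-⊆ T⊆S nonzero
... | (i , 0<tᵢ) ∷ _ = <-irrefl refl (<-≤-trans σᵢ<nᵢ nᵢ≤σᵢ)
  where
    σᵢ<nᵢ : σ i (t ∷ T) < _
    σᵢ<nᵢ = ≤-<-trans (sum-map-⊆ (λ g → toℕ (g i)) T⊆S) (σ< i)
    nᵢ≤σᵢ = ∣⇒≤ {{ℕ.>-nonZero (≤-trans 0<tᵢ (m≤m+n _ _))}} (t∷T≡0 i)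

unit₀ : ∀ {k} {ns : Fin (suc k) → ℕ} → (∀ i → 1 < ns i) → Elem ns
unit₀ 1<ns zero    = fromℕ< (1<ns zero)
unit₀ 1<ns (suc i) = fromℕ< (<-trans (s≤s z≤n) (1<ns (suc i)))

pad₀ : ∀ {k} {ns : Fin (suc k) → ℕ} → (∀ i → 1 < ns i) → Elem (ns ∘ suc) → Elem ns
pad₀ 1<ns g zero    = fromℕ< (<-trans (s≤s z≤n) (1<ns zero))
pad₀ 1<ns g (suc i) = g i

basis : ∀ {k} (ns : Fin k → ℕ) → (∀ i → 1 < ns i) → Seq ns
basis {zero}  ns _    = []
basis {suc k} ns 1<ns =
  List.replicate (pred (ns zero)) (unit₀ 1<ns) ++ map (pad₀ 1<ns) (basis (ns ∘ suc) (1<ns ∘ suc))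

length-basis : ∀ {k} (ns : Fin k → ℕ) 1<ns → length (basis ns 1<ns) ≡ d* ns
length-basis {zero}  ns 1<ns = refl
length-basis {suc k} ns 1<ns = begin
  length (List.replicate (pred (ns zero)) (unit₀ 1<ns) ++ map (pad₀ 1<ns) B)
    ≡⟨ length-++ (List.replicate (pred (ns zero)) (unit₀ 1<ns)) ⟩
  length (List.replicate (pred (ns zero)) (unit₀ 1<ns)) + length (map (pad₀ 1<ns) B)
    ≡⟨ cong₂ _+_ (length-replicate (pred (ns zero)))
                 (trans (length-map (pad₀ 1<ns) B) (length-basis (ns ∘ suc) (1<ns ∘ suc))) ⟩
  d* ns ∎
  where open ≡-Reasoning
        B = basis (ns ∘ suc) (1<ns ∘ suc)

σ-++ : ∀ {k} {ns : Fin k → ℕ} i (T U : Seq ns) → σ i (T ++ U) ≡ σ i T + σ i U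
σ-++ i T U = trans (cong sum (map-++ (λ g → toℕ (g i)) T U)) (sum-++ (map (λ g → toℕ (g i)) T) _)

σ-replicate : ∀ {k} {ns : Fin k → ℕ} i n (g : Elem ns) → σ i (List.replicate n g) ≡ n * toℕ (g i)
σ-replicate i zero    g = refl
σ-replicate i (suc n) g = cong (_+_ (toℕ (g i))) (σ-replicate i n g)

σ₀-pad₀ : ∀ {k} {ns : Fin (suc k) → ℕ} 1<ns (T : Seq (ns ∘ suc)) →
          σ zero (map (pad₀ {ns = ns} 1<ns) T) ≡ 0
σ₀-pad₀ 1<ns []      = refl
σ₀-pad₀ 1<ns (g ∷ T) = cong₂ _+_ (toℕ-fromℕ< _) (σ₀-pad₀ 1<ns T)

σ-basis : ∀ {k} (ns : Fin k → ℕ) 1<ns i → σ i (basis ns 1<ns) ≡ pred (ns i)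
σ-basis {suc k} ns 1<ns i =
  trans (σ-++ i (List.replicate (pred (ns zero)) (unit₀ 1<ns)) _)
        (trans (cong (_+ σ i (map (pad₀ 1<ns) B)) (σ-replicate i (pred (ns zero)) (unit₀ 1<ns)))
               (coordinate i))
  where
    B = basis (ns ∘ suc) (1<ns ∘ suc)
    coordinate : ∀ i → pred (ns zero) * toℕ (unit₀ 1<ns i) + σ i (map (pad₀ 1<ns) B) ≡ pred (ns i)
    coordinate zero rewrite toℕ-fromℕ< (1<ns zero) | σ₀-pad₀ 1<ns B = trans (+-identityʳ _) (*-identityʳ _)
    coordinate (suc i) rewrite toℕ-fromℕ< (<-trans (s≤s z≤n) (1<ns (suc i))) | *-zeroʳ (pred (ns zero)) =
      trans (cong sum (sym (map-∘ B))) (σ-basis (ns ∘ suc) (1<ns ∘ suc) i)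

basis-nonzero : ∀ {k} (ns : Fin k → ℕ) 1<ns → All NonZeroElem (basis ns 1<ns)
basis-nonzero {zero}  ns 1<ns = []
basis-nonzero {suc k} ns 1<ns =
  ++⁺ (replicate⁺ (pred (ns zero)) (zero , subst (0 <_) (sym (toℕ-fromℕ< (1<ns zero))) (s≤s z≤n)))
      (gmap⁺ (λ { (i , 0<gᵢ) → suc i , 0<gᵢ }) (basis-nonzero (ns ∘ suc) (1<ns ∘ suc)))

d*≤D : ∀ {k} (ns : Fin k → ℕ) → (∀ i → 1 < ns i) → ∀ {D} → IsSmallDavenport ns D → d* ns ≤ D
d*≤D ns 1<ns (_ , maximal) = subst (_≤ _) (length-basis ns 1<ns)
  (maximal (basis ns 1<ns) (σ<⇒zeroSumFree (basis ns 1<ns) (basis-nonzero ns 1<ns) σ-basis<))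
  where
    σ-basis< : ∀ i → σ i (basis ns 1<ns) < ns i
    σ-basis< i = subst (_< ns i) (sym (σ-basis ns 1<ns i))
                   (≤-reflexive (suc-pred (ns i) {{ℕ.>-nonZero (<-trans (s≤s z≤n) (1<ns i))}}))

lookup-× : ∀ {k} n (v : Vec ℕ k) i → lookup (ℕᵏ-Differences._×_ k n v) i ≡ n * lookup v i
lookup-× zero    v i = lookup-replicate i 0
lookup-× (suc n) v i = trans (lookup-zipWith _+_ i v _) (cong (_+_ (lookup v i)) (lookup-× n v i))

toVec-multiple : ∀ {k} {ns : Fin k → ℕ} {p} (g : Elem ns) → (∀ i → p ∣ toℕ (g i)) →
                 ∃ λ h → toVec g ≡ ℕᵏ-Differences._×_ k p h
toVec-multiple {k} {p = p} g p∣g =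
  h , trans (tabulate-cong coordinate) (tabulate∘lookup (ℕᵏ-Differences._×_ k p h))
  where
    h = tabulate (λ i → quotient (p∣g i))
    coordinate : ∀ i → toℕ (g i) ≡ lookup (ℕᵏ-Differences._×_ k p h) i
    coordinate i = begin
      toℕ (g i)                           ≡⟨ _∣_.equality (p∣g i) ⟩
      quotient (p∣g i) * p                ≡⟨ *-comm (quotient (p∣g i)) p ⟩
      p * quotient (p∣g i)                ≡⟨ cong (p *_) (lookup∘tabulate _ i) ⟨
      p * lookup h i                      ≡⟨ lookup-× p h i ⟨
      lookup (ℕᵏ-Differences._×_ k p h) i ∎
      where open ≡-Reasoning

d*-lower-bound : ∀ {p} → Prime p → ∀ {k} (ns : Fin k → ℕ) → (∀ i → ∃ λ e → ns i ≡ p ^ e) →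
                 ∀ S → ZeroSumFree ns S → ∀ {g} → g ∈ S → (∀ i → p ∣ toℕ (g i)) →
                 length S + p ≤ suc (d* ns)
d*-lower-bound {p} p-prime {k} ns p-powers S zsf {g} g∈S p∣g = ≮⇒≥ too-long
  where
    open ℕᵏ-Differences k
    open Modulo p
    open Congruence p
    too-long : ¬ suc (d* ns) < length S + p
    too-long long with ∈-∃++ g∈S | toVec-multiple g p∣g
    ... | S₁ , S₂ , refl | h , g≡ph =
      1≉0 p-prime (≈-trans (≈-reflexive (sym (Δ*-zeroIndicator ns S zsf))) vanishes)
      where
        vanishes : Δ* (map toVec S) (zeroIndicator ns) (replicate k 0) ≈ 0ℤ
        vanishes rewrite map-++ toVec S₁ (g ∷ S₂) | g≡ph =
          Deg<⇒≈0 (Deg<-Δ*-× p-prime (map toVec S₁) h (map toVec S₂)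
                     (Deg<-≤ budget (Deg<-zeroIndicator p-prime ns p-powers))) (replicate k 0)
          where
            identity : ∀ a b q → a + suc b + q ≡ suc (a + (q + (b + 0)))
            identity = ℕ-Solver.solve-∀
            budget : suc (d* ns) ≤ length (map toVec S₁) + (p + (length (map toVec S₂) + 0))
            budget rewrite length-map toVec S₁ | length-map toVec S₂ =
              ≤-pred (≤-trans long (≤-reflexive
                (trans (cong (_+ p) (length-++ S₁)) (identity (length S₁) (length S₂) p))))

head∣ : ∀ {r} (a : Fin (suc r) → ℕ) → (∀ i → a (inject₁ i) ∣ a (suc i)) → ∀ i → a zero ∣ a i
head∣ a chain zero = ∣-refl
head∣ {suc r} a chain (suc i) = ∣-trans (chain zero) (head∣ (a ∘ suc) (chain ∘ suc) i)

prime^e∣m*n⇒prime^e∣m : ∀ {p n} → Prime p → ¬ p ∣ n → ∀ e {m} → p ^ e ∣ m * n → p ^ e ∣ m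
prime^e∣m*n⇒prime^e∣m p-prime p∤n zero    {m} _ = 1∣ m
prime^e∣m*n⇒prime^e∣m {p} {n} p-prime p∤n (suc e) {m} p^[1+e]∣mn
  with euclidsLemma m n p-prime (∣-trans (m∣m*n (p ^ e)) p^[1+e]∣mn)
... | inj₂ p∣n = contradiction p∣n p∤n
... | inj₁ (divides q refl) = subst (p * p ^ e ∣_) (*-comm p q)
      (*-monoʳ-∣ p (prime^e∣m*n⇒prime^e∣m p-prime p∤n e
        (*-cancelˡ-∣ p {{prime⇒nonZero p-prime}} (subst (p * p ^ e ∣_) regroup p^[1+e]∣mn))))
  where regroup : q * p * n ≡ p * (q * n)
        regroup = trans (cong (_* n) (*-comm q p)) (*-assoc p q n)

prime∣coordinates : ∀ {p k} → Prime p → (ns : Fin k → ℕ) → (∀ i → ∃ λ e → ns i ≡ p ^ e) →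
                    ∀ {d} → (∀ i → d ∣ ns i) → ∀ {m g} → Annihilates ns m g → ¬ d ∣ m →
                    ∀ i → p ∣ toℕ (g i)
prime∣coordinates {p} p-prime ns p-powers d∣ns {m} {g} m·g≡0 d∤m i with p ∣? toℕ (g i) | p-powers i
... | yes p∣gᵢ | _          = p∣gᵢ
... | no  p∤gᵢ | e , nᵢ≡pᵉ = contradiction (∣-trans (d∣ns i) nᵢ∣m) d∤m
  where nᵢ∣m = subst (_∣ m) (sym nᵢ≡pᵉ)
                 (prime^e∣m*n⇒prime^e∣m p-prime p∤gᵢ e (subst (_∣ m * toℕ (g i)) nᵢ≡pᵉ (m·g≡0 i)))

theorem5p2 : (p r : ℕ) → Prime p → (ns : Fin (suc r) → ℕ)
    → (∀ i → ∃ λ e → ns i ≡ p ^ e)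
    → 1 < ns zero
    → (∀ (i : Fin r) → ns (inject₁ i) ∣ ns (suc i))
    → (D : ℕ) → IsSmallDavenport ns D
    → (S : Seq ns) → ZeroSumFree ns S → D + 2 ≤ length S + p
    → ∀ g → g ∈ S → ∀ m → IsOrder ns g m → ns zero ∣ m
theorem5p2 p r p-prime ns p-powers 1<n₀ chain D dav S zsf long g g∈S m (_ , m·g≡0 , _) with ns zero ∣? m
... | yes n₀∣m = n₀∣m
... | no  n₀∤m = contradiction (subst (_≤ suc D) (+-comm D 2) D+2≤1+D) (<-irrefl refl)
  where
    1<ns : ∀ i → 1 < ns i
    1<ns i = <-≤-trans 1<n₀ (∣⇒≤ {{prime-power-nonZero p-prime (p-powers i)}} (head∣ ns chain i))
    p∣g : ∀ i → p ∣ toℕ (g i)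
    p∣g = prime∣coordinates p-prime ns p-powers (head∣ ns chain) m·g≡0 n₀∤m
    D+2≤1+D : D + 2 ≤ suc D
    D+2≤1+D = ≤-trans long
                (≤-trans (d*-lower-bound p-prime ns p-powers S zsf g∈S p∣g) (s≤s (d*≤D ns 1<ns dav)))
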